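{- Let $\rho\in\mathbb N$ and $\tau\in\mathbb N^*$. Let $H$ be a $\tau$-Galton–Watson forest conditioned to have exactly $\rho$ tree-vertices (assume this event has positive probability). Given $H$, label it as follows: floors get label $0$, children of floors get label $-1$, and independently for each tree-vertex $v$ with $c=c_v(H)\geq1$ children, the labels of $v1,\dots,vc$ are obtained as $\ell(v)+x_1,\dots,\ell(v)+x_c$ where $(x_1,\dots,x_c)$ is uniformly chosen among the $\binom{c+2}{2}$ non-decreasing sequences in $\{ -1,0,1\}^c$. Then the resulting well-labeled forest $(H,\ell)$ is uniformly distributed on $\mathcal F^\rho_\tau$.
   Context: Forests: $\mathcal F=\bigcup_{k\geq1}(\mathbb N^*)^k$ (finite nonempty words over positive integers), $|u|$ the length, $pa(w)$ the word $w$ with last letter removed ($|w|\geq2$), $w$ a child of $pa(w)$. A forest is a nonempty finite $F\subseteq\mathcal F$ with: $\{u\in F:|u|=1\}=\{1,\dots,t(F)+1\}$ for some $t(F)\in\mathbb N$; $pa(u)\in F$ for $u\in F$, $|u|\geq2$; for each $u\in F$ some $c_u(F)\in\mathbb N$ with $ui\in F$ iff $i\leq c_u(F)$; $c_{t(F)+1}(F)=0$. Elements of length $1$ are floors, elements of length $\geq2$ are tree-vertices. $\mathbb F^\rho_\tau$: forests with $t(F)=\tau$ and $\rho+\tau+1$ elements (i.e. $\rho$ tree-vertices). A well-labeled forest is $(F,\ell)$ with $\ell:F\to\mathbb Z$, $\ell(u)=0$ if $|u|=1$, $\ell(u)=-1$ if $|u|=2$, and $\ell(u)-1\leq\ell(u1)\leq\dots\leq\ell(u\,c_u(F))\leq\ell(u)+1$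 whenever $|u|\geq2$, $c_u(F)\geq1$; $\mathcal F^\rho_\tau$ is the set of those with $F\in\mathbb F^\rho_\tau$. Let $G$ be geometric with $\mathbb P(G=c)=\frac34\left(\frac14\right)^c$, $c\in\mathbb N$, and $B$ with $\mathbb P(B=c)=\binom{c+2}{2}\mathbb P(G=c)/\mathbb E\left[\binom{G+2}{2}\right]$. A $\tau$-Galton–Watson forest is a random forest $F'$ with $t(F')=\tau$ such that the numbers of children $c_u(F')$ are independent, with law $G$ for the floors $u\in\{1,\dots,\tau\}$ (the floor $\tau+1$ having no child) and law $B$ for tree-vertices. -}

module Defs where

open import Data.Nat using (ℕ; zero; suc; _+_)
open import Data.Nat.Combinatorics using (_C_)
open import Data.Integer using (ℤ; +_; -[1+_]; _≤_) renaming (_+_ to _+ℤ_; _-_ to _-ℤ_)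
open import Data.Rational using (ℚ; _/_; _*_; _÷_; 0ℚ; 1ℚ)
open import Data.List using (List; []; _∷_; map; length)
open import Data.List.Relation.Unary.All using (All)
open import Data.List.Relation.Unary.Linked using (Linked)
open import Data.Vec using (Vec; []; _∷_)
open import Data.Product using (_×_)
open import Relation.Binary.PropositionalEquality using (_≡_)

-- A forest F with t(F) = τ is encoded by the list of children subtrees of
-- each floor 1,…,τ (floor τ+1 has no child).

data Tree : Set where
  node : List Tree → Tree

mutual
  size : Tree → ℕ
  size (node ts) = suc (sizes ts)

  sizes : List Tree → ℕ
  sizes []       = 0
  sizes (t ∷ ts) = size t + sizes ts

Forest : ℕ → Set
Forest τ = Vec (List Tree) τ

-- number of tree-vertices (elements of length ≥ 2)
treeVertices : ∀ {τ} → Forest τ → ℕ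
treeVertices []         = 0
treeVertices (ts ∷ fs)  = sizes ts + treeVertices fs

-- Labelled forests: each tree-vertex carries an integer label
-- (floors implicitly carry label 0).

data LTree : Set where
  lnode : ℤ → List LTree → LTree

label : LTree → ℤ
label (lnode l _) = l

mutual
  shape : LTree → Tree
  shape (lnode _ ts) = node (shapes ts)

  shapes : List LTree → List Tree
  shapes []       = []
  shapes (t ∷ ts) = shape t ∷ shapes ts

LForest : ℕ → Set
LForest τ = Vec (List LTree) τ

forestShape : ∀ {τ} → LForest τ → Forest τ
forestShape []        = []
forestShape (ts ∷ fs) = shapes ts ∷ forestShape fs

data WellLabeledTree : LTree → Set where
  wl : ∀ {l ts} →
       Linked _≤_ (map label ts) →
       All (λ t → (l -ℤ + 1) ≤ label t × label t ≤ (l +ℤ + 1)) ts →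
       All WellLabeledTree ts →
       WellLabeledTree (lnode l ts)

data WellLabeled : ∀ {τ} → LForest τ → Set where
  []  : WellLabeled []
  _∷_ : ∀ {τ ts} {fs : LForest τ} →
        All (λ t → label t ≡ -[1+ 0 ] × WellLabeledTree t) ts →
        WellLabeled fs → WellLabeled (ts ∷ fs)

pow : ℚ → ℕ → ℚ
pow q zero    = 1ℚ
pow q (suc n) = q * pow q n

pG : ℕ → ℚ
pG c = (+ 3 / 4) * pow (+ 1 / 4) c

-- E[binom(G+2,2)] = Σ_c binom(c+2,2)(3/4)(1/4)^c = (3/4)(3/4)^{-3} = 16/9
EbinomG : ℚ
EbinomG = + 16 / 9

pB : ℕ → ℚ
pB c = ((+ ((2 + c) C 2) / 1) * pG c) ÷ EbinomG

-- 1/n (only used for n ≥ 1)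
inv : ℕ → ℚ
inv zero    = 0ℚ
inv (suc n) = + 1 / suc n

-- probability of one particular non-decreasing sequence in {-1,0,1}^c
-- when chosen uniformly among the binom(c+2,2) of them
pIncr : ℕ → ℚ
pIncr c = inv ((2 + c) C 2)

mutual
  treeProbB : Tree → ℚ
  treeProbB (node ts) = pB (length ts) * treesProbB ts

  treesProbB : List Tree → ℚ
  treesProbB []       = 1ℚ
  treesProbB (t ∷ ts) = treeProbB t * treesProbB ts

-- P(F' = F) for a τ-Galton–Watson forest F'
gwProb : ∀ {τ} → Forest τ → ℚ
gwProb []        = 1ℚ
gwProb (ts ∷ fs) = pG (length ts) * treesProbB ts * gwProb fs

mutual
  -- Π over tree-vertices v of the probability of the chosen increments
  -- (for c_v = 0 the factor is 1/binom(2,2) = 1)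
  labelProbT : LTree → ℚ
  labelProbT (lnode _ ts) = pIncr (length ts) * labelProbTs ts

  labelProbTs : List LTree → ℚ
  labelProbTs []       = 1ℚ
  labelProbTs (t ∷ ts) = labelProbT t * labelProbTs ts

labelProb : ∀ {τ} → LForest τ → ℚ
labelProb []        = 1ℚ
labelProb (ts ∷ fs) = labelProbTs ts * labelProb fs

-- P(F' = shape of L, labels = ℓ) : joint probability (before conditioning)
-- that the GW forest with the random labelling equals L.
jointProb : ∀ {τ} → LForest τ → ℚ
jointProb L = gwProb (forestShape L) * labelProb L

InFρτ : ∀ {τ} → ℕ → LForest τ → Set
InFρτ ρ L = WellLabeled L × treeVertices (forestShape L) ≡ ρ

{-# OPTIONS --safe #-}
module Submission where

-- A tree-vertex with c children is produced with probability P(B = c) and its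
-- increments with probability 1/binom(c+2,2); the binomial coefficients cancel,
-- leaving κ (1/4)^c with κ = (3/4)/E[binom(G+2,2)].  A floor with c children
-- contributes (3/4)(1/4)^c.  Every tree-vertex is the child of exactly one
-- vertex, so the powers of 1/4 multiply to (1/4)^ρ and the probability of any
-- labelled forest with τ+1 floors and ρ tree-vertices is (3/4)^τ (κ/4)^ρ.
-- As this does not depend on the forest, the conditioned law is uniform.

open import Defs
open import Data.Nat using (ℕ; _≤_)
open import Data.Product using (∃)
open import Relation.Binary.PropositionalEquality using (_≡_)

open import Algebra.Bundles using (CommutativeMonoid)
open import Data.Integer using (+_)
open import Data.List using (List; []; _∷_; length)
open import Data.Nat as ℕ using (suc; NonZero)
open import Data.Nat.Combinatorics using (_C_; nCk+nC[k+1]≡[n+1]C[k+1]; nC1≡n)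
open import Data.Nat.Coprimality using (1-coprimeTo) renaming (sym to coprime-sym)
open import Data.Product using (_,_)
open import Data.Rational using (ℚ; mkℚ; _/_; _*_; _÷_; 1/_; 1ℚ)
open import Data.Rational.Properties
  using (*-assoc; *-identityˡ; *-inverseʳ; normalize-coprime; *-1-commutativeMonoid)
open import Data.Vec using ([]; _∷_)
open import Relation.Binary.PropositionalEquality using (refl; sym; trans; cong; cong₂)
open Relation.Binary.PropositionalEquality.≡-Reasoning

open import Algebra.Properties.CommutativeSemigroup
  (CommutativeMonoid.commutativeSemigroup *-1-commutativeMonoid)
  using (interchange; xy∙z≈xz∙y)

pow-distribˡ-+-* : ∀ x m n → pow x (m ℕ.+ n) ≡ pow x m * pow x n
pow-distribˡ-+-* x ℕ.zero  n = sym (*-identityˡ (pow x n))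
pow-distribˡ-+-* x (suc m) n = trans (cong (x *_) (pow-distribˡ-+-* x m n)) (sym (*-assoc x (pow x m) (pow x n)))

length-shapes : ∀ ts → length (shapes ts) ≡ length ts
length-shapes []       = refl
length-shapes (t ∷ ts) = cong suc (length-shapes ts)

[2+c]C2≡1+c+[1+c]C2 : ∀ c → (2 ℕ.+ c) C 2 ≡ suc c ℕ.+ suc c C 2
[2+c]C2≡1+c+[1+c]C2 c =
  trans (sym (nCk+nC[k+1]≡[n+1]C[k+1] (suc c) 1)) (cong (ℕ._+ suc c C 2) (nC1≡n (suc c)))

n/1*inv[n]≡1 : ∀ n .{{_ : NonZero n}} → (+ n / 1) * inv n ≡ 1ℚ
n/1*inv[n]≡1 (suc m)
  rewrite normalize-coprime {suc m} {0} (coprime-sym (1-coprimeTo (suc m)))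
        | normalize-coprime {1} {m} (1-coprimeTo (suc m))
  = *-inverseʳ (mkℚ (+ suc m) 0 (coprime-sym (1-coprimeTo (suc m))))

n/1*x*inv[n]≡x : ∀ n .{{_ : NonZero n}} x → ((+ n / 1) * x) * inv n ≡ x
n/1*x*inv[n]≡x n x = begin
  ((+ n / 1) * x) * inv n  ≡⟨ xy∙z≈xz∙y (+ n / 1) x (inv n) ⟩
  ((+ n / 1) * inv n) * x  ≡⟨ cong (_* x) (n/1*inv[n]≡1 n) ⟩
  1ℚ * x                   ≡⟨ *-identityˡ x ⟩
  x                        ∎

g q κ r : ℚ
g = + 3 / 4
q = + 1 / 4
κ = g ÷ EbinomG
r = q * κ

pB*pIncr≡κ*q^c : ∀ c → pB c * pIncr c ≡ κ * pow q c
pB*pIncr≡κ*q^c c rewrite [2+c]C2≡1+c+[1+c]C2 c = begin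
  ((N / 1 * pG c) * D) * inv n  ≡⟨ cong (_* inv n) (*-assoc (N / 1) (pG c) D) ⟩
  (N / 1 * (pG c * D)) * inv n  ≡⟨ n/1*x*inv[n]≡x n (pG c * D) ⟩
  (g * pow q c) * D             ≡⟨ xy∙z≈xz∙y g (pow q c) D ⟩
  κ * pow q c                   ∎
  where
    n = suc c ℕ.+ suc c C 2
    N = + n
    D = 1/ EbinomG

weight : LTree → ℚ
weight t = treeProbB (shape t) * labelProbT t

weights : List LTree → ℚ
weights ts = treesProbB (shapes ts) * labelProbTs ts

weight-lnode : ∀ l ts → weight (lnode l ts) ≡ (pB (length ts) * pIncr (length ts)) * weights ts
weight-lnode l ts rewrite length-shapes ts =
  interchange (pB (length ts)) (treesProbB (shapes ts)) (pIncr (length ts)) (labelProbTs ts)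

weights-∷ : ∀ t ts → weights (t ∷ ts) ≡ weight t * weights ts
weights-∷ t ts = interchange (treeProbB (shape t)) (treesProbB (shapes ts)) (labelProbT t) (labelProbTs ts)

mutual
  q*weight≡r^size : ∀ t → q * weight t ≡ pow r (size (shape t))
  q*weight≡r^size (lnode l ts) = begin
    q * weight (lnode l ts)                       ≡⟨ cong (q *_) (weight-lnode l ts) ⟩
    q * ((pB n * pIncr n) * weights ts)           ≡⟨ cong (λ x → q * (x * weights ts)) (pB*pIncr≡κ*q^c n) ⟩
    q * ((κ * pow q n) * weights ts)              ≡⟨ cong (q *_) (*-assoc κ (pow q n) (weights ts)) ⟩
    q * (κ * (pow q n * weights ts))              ≡⟨ sym (*-assoc q κ (pow q n * weights ts)) ⟩
    r * (pow q n * weights ts)                    ≡⟨ cong (r *_) (q^length*weights≡r^sizes ts) ⟩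
    r * pow r (sizes (shapes ts))                 ∎
    where n = length ts

  q^length*weights≡r^sizes : ∀ ts → pow q (length ts) * weights ts ≡ pow r (sizes (shapes ts))
  q^length*weights≡r^sizes []       = *-identityˡ 1ℚ
  q^length*weights≡r^sizes (t ∷ ts) = begin
    (q * pow q (length ts)) * weights (t ∷ ts)                ≡⟨ cong (q * pow q (length ts) *_) (weights-∷ t ts) ⟩
    (q * pow q (length ts)) * (weight t * weights ts)         ≡⟨ interchange q (pow q (length ts)) (weight t) (weights ts) ⟩
    (q * weight t) * (pow q (length ts) * weights ts)         ≡⟨ cong₂ _*_ (q*weight≡r^size t) (q^length*weights≡r^sizes ts) ⟩
    pow r (size (shape t)) * pow r (sizes (shapes ts))        ≡⟨ sym (pow-distribˡ-+-* r (size (shape t)) _) ⟩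
    pow r (sizes (shapes (t ∷ ts)))                           ∎

jointProb-∷ : ∀ {τ} ts (fs : LForest τ) →
              jointProb (ts ∷ fs) ≡ (pG (length ts) * weights ts) * jointProb fs
jointProb-∷ ts fs rewrite length-shapes ts = begin
  ((pG n * A) * G) * (B * L)  ≡⟨ interchange (pG n * A) G B L ⟩
  ((pG n * A) * B) * (G * L)  ≡⟨ cong (_* (G * L)) (*-assoc (pG n) A B) ⟩
  (pG n * (A * B)) * (G * L)  ∎
  where
    n = length ts
    A = treesProbB (shapes ts)
    B = labelProbTs ts
    G = gwProb (forestShape fs)
    L = labelProb fs

jointProb≡g^τ*r^treeVertices : ∀ {τ} (L : LForest τ) →
                               jointProb L ≡ pow g τ * pow r (treeVertices (forestShape L))
jointProb≡g^τ*r^treeVertices []        = refl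
jointProb≡g^τ*r^treeVertices {suc τ} (ts ∷ fs) = begin
  jointProb (ts ∷ fs)                             ≡⟨ jointProb-∷ ts fs ⟩
  ((g * pow q n) * weights ts) * jointProb fs     ≡⟨ cong (_* jointProb fs) (*-assoc g (pow q n) (weights ts)) ⟩
  (g * (pow q n * weights ts)) * jointProb fs     ≡⟨ cong₂ (λ x y → (g * x) * y) (q^length*weights≡r^sizes ts)
                                                                               (jointProb≡g^τ*r^treeVertices fs) ⟩
  (g * pow r S) * (pow g τ * pow r T)             ≡⟨ interchange g (pow r S) (pow g τ) (pow r T) ⟩
  (g * pow g τ) * (pow r S * pow r T)             ≡⟨ cong (pow g (suc τ) *_) (sym (pow-distribˡ-+-* r S T)) ⟩
  pow g (suc τ) * pow r (S ℕ.+ T)                 ∎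
  where
    n = length ts
    S = sizes (shapes ts)
    T = treeVertices (forestShape fs)

lemma28 : (ρ τ : ℕ) → 1 ≤ τ →
          (∃ λ (F : Forest τ) → treeVertices F ≡ ρ) →
          (L₁ L₂ : LForest τ) → InFρτ ρ L₁ → InFρτ ρ L₂ →
          jointProb L₁ ≡ jointProb L₂
lemma28 ρ τ _ _ L₁ L₂ (_ , size₁≡ρ) (_ , size₂≡ρ) = begin
  jointProb L₁                                       ≡⟨ jointProb≡g^τ*r^treeVertices L₁ ⟩
  pow g τ * pow r (treeVertices (forestShape L₁))    ≡⟨ cong (λ k → pow g τ * pow r k) (trans size₁≡ρ (sym size₂≡ρ)) ⟩
  pow g τ * pow r (treeVertices (forestShape L₂))    ≡⟨ sym (jointProb≡g^τ*r^treeVertices L₂) ⟩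
  jointProb L₂                                       ∎
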